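{- Let $F$ be a CNF formula and $c \in F$ a clause such that some variable occurs in $F$ only in the clause $c$. Then every clause $c' \in F$ with $c' \neq c$ is superredundant in $F$ if and only if it is superredundant in $F \setminus \{c\}$.
   Context: A CNF formula is a finite set of clauses; a clause is a finite set of literals, read as their disjunction. Tautological clauses are not allowed. Resolution: from clauses $c_1 \vee l$ and $c_2 \vee \neg l$ derive $c_1 \vee c_2$; two clauses whose resolvent would be a tautology are considered not to resolve. The resolution closure $\mathrm{ResCn}(F)$ is the set of all clauses obtainable from $F$ by zero or more resolution steps. A clause $c \in F$ is superredundant in $F$ if $\mathrm{ResCn}(F) \setminus \{c\} \models c$. -}

module Defs where

open import Data.Nat using (ℕ)
open import Data.Bool using (Bool; true; false; not)
open import Data.Product using (Σ; ∃; ∃-syntax; _×_; _,_)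
open import Data.Sum using (_⊎_)
open import Data.List using (List; filter)
open import Data.List.Membership.Propositional using (_∈_)
open import Relation.Binary.PropositionalEquality using (_≡_; _≢_; refl; cong)
open import Relation.Nullary using (¬_; Dec; yes; no)
open import Relation.Nullary.Decidable using (_×-dec_; ¬?)
open import Relation.Binary.Definitions using (DecidableEquality)
import Data.Nat.Properties as ℕP

data Lit : Set where
  pos : ℕ → Lit
  neg : ℕ → Lit

~_ : Lit → Lit
~ pos x = neg x
~ neg x = pos x

_≟L_ : DecidableEquality Lit
pos x ≟L pos y with x ℕP.≟ y
... | yes refl = yes refl
... | no x≢y = no λ { refl → x≢y refl }
pos x ≟L neg y = no λ ()
neg x ≟L pos y = no λ ()
neg x ≟L neg y with x ℕP.≟ y
... | yes refl = yes refl
... | no x≢y = no λ { refl → x≢y refl }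

open import Data.List.Relation.Binary.Subset.DecPropositional _≟L_ using (_⊆_; _⊆?_)

-- A clause is a finite set of literals, represented by a list
-- (order and multiplicity are irrelevant: clauses are compared extensionally).
Clause : Set
Clause = List Lit

_≋_ : Clause → Clause → Set
c ≋ d = (c ⊆ d) × (d ⊆ c)

_≋?_ : (c d : Clause) → Dec (c ≋ d)
c ≋? d = (c ⊆? d) ×-dec (d ⊆? c)

Formula : Set
Formula = List Clause

_∈F_ : Clause → Formula → Set
c ∈F F = ∃[ d ] (d ∈ F × c ≋ d)

_∖F_ : Formula → Clause → Formula
F ∖F c = filter (λ d → ¬? (d ≋? c)) F

Tautology : Clause → Set
Tautology c = ∃[ l ] (l ∈ c × (~ l) ∈ c)

NoTaut : Formula → Set
NoTaut F = ∀ d → d ∈F F → ¬ Tautology d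

Occurs : ℕ → Clause → Set
Occurs x c = (pos x ∈ c) ⊎ (neg x ∈ c)

Resolvent : Clause → Clause → Clause → Set
Resolvent c₁ c₂ r =
  ∃[ l ] ( l ∈ c₁ × (~ l) ∈ c₂
         × (∀ m → (m ∈ r → (m ∈ c₁ × m ≢ l) ⊎ (m ∈ c₂ × m ≢ ~ l))
                × ((m ∈ c₁ × m ≢ l) ⊎ (m ∈ c₂ × m ≢ ~ l) → m ∈ r))
         × ¬ Tautology r )

data ResCn (F : Formula) : Clause → Set where
  base : ∀ {c} → c ∈F F → ResCn F c
  step : ∀ {c₁ c₂ r} → ResCn F c₁ → ResCn F c₂ → Resolvent c₁ c₂ r → ResCn F r

Assignment : Set
Assignment = ℕ → Bool

evalLit : Assignment → Lit → Bool
evalLit σ (pos x) = σ x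
evalLit σ (neg x) = not (σ x)

Sat : Assignment → Clause → Set
Sat σ c = ∃[ l ] (l ∈ c × evalLit σ l ≡ true)

Superredundant : Formula → Clause → Set
Superredundant F c =
  c ∈F F × (∀ (σ : Assignment) → (∀ d → ResCn F d → ¬ (d ≋ c) → Sat σ d) → Sat σ c)

{-# OPTIONS --safe #-}
-- Let l be the literal of the isolated variable x in c. Every clause of
-- ResCn F is either already in ResCn (F ∖ {c}) or still contains l: a
-- resolution step can only remove l by clashing it against ¬ l, which lives
-- in no clause derivable without c and in no clause containing l (no
-- tautologies). Clauses derived without c do not mention x, and neither does
-- c′. So if σ satisfies ResCn (F ∖ {c}) ∖ {c′}, then σ with l made true
-- satisfies ResCn F ∖ {c′}; superredundancy in F gives c′ under it, hence
-- under σ. The converse holds because ResCn is monotone.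
module Submission where

open import Defs
open import Data.Bool using (Bool; true; false; if_then_else_)
open import Data.List.Membership.Propositional using (_∈_; _∉_)
open import Data.List.Membership.Propositional.Properties using (∈-filter⁺; ∈-filter⁻)
open import Data.List.Relation.Binary.Subset.Propositional.Properties using (⊆-trans)
open import Data.Nat using (ℕ; _≟_)
open import Data.Product using (∃-syntax; _×_; _,_; proj₁; proj₂)
open import Data.Sum using (_⊎_; inj₁; inj₂)
open import Function.Bundles using (_⇔_; mk⇔; Equivalence)
open import Relation.Binary.PropositionalEquality using (_≡_; _≢_; refl; sym; trans; cong; subst)
open import Relation.Nullary using (¬_; does; yes; no)
open import Relation.Nullary.Decidable using (¬?; dec-true; dec-false)

var : Lit → ℕ
var (pos x) = x
var (neg x) = x

~-involutive : ∀ l → ~ (~ l) ≡ l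
~-involutive (pos x) = refl
~-involutive (neg x) = refl

∈⇒Occurs-var : ∀ {l d} → l ∈ d → Occurs (var l) d
∈⇒Occurs-var {pos x} l∈d = inj₁ l∈d
∈⇒Occurs-var {neg x} l∈d = inj₂ l∈d

~∈⇒Occurs-var : ∀ {l d} → (~ l) ∈ d → Occurs (var l) d
~∈⇒Occurs-var {pos x} ~l∈d = inj₂ ~l∈d
~∈⇒Occurs-var {neg x} ~l∈d = inj₁ ~l∈d

≋-sym : ∀ {c d} → c ≋ d → d ≋ c
≋-sym (c⊆d , d⊆c) = d⊆c , c⊆d

≋-trans : ∀ {c d e} → c ≋ d → d ≋ e → c ≋ e
≋-trans (c⊆d , d⊆c) (d⊆e , e⊆d) = ⊆-trans c⊆d d⊆e , ⊆-trans e⊆d d⊆c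

∈F-∖F⁺ : ∀ {F c d} → d ∈F F → ¬ d ≋ c → d ∈F (F ∖F c)
∈F-∖F⁺ {c = c} (e , e∈F , d≋e) d≉c =
  e , ∈-filter⁺ (λ e → ¬? (e ≋? c)) e∈F (λ e≋c → d≉c (≋-trans d≋e e≋c)) , d≋e

∈F-∖F⁻ : ∀ {F c d} → d ∈F (F ∖F c) → d ∈F F × ¬ d ≋ c
∈F-∖F⁻ {F} {c} (e , e∈F∖c , d≋e) =
  let e∈F , e≉c = ∈-filter⁻ (λ e → ¬? (e ≋? c)) {xs = F} e∈F∖c
  in (e , e∈F , d≋e) , λ d≋c → e≉c (≋-trans (≋-sym d≋e) d≋c)

Resolvent-⊆ : ∀ {c₁ c₂ r m} → Resolvent c₁ c₂ r → m ∈ r → m ∈ c₁ ⊎ m ∈ c₂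
Resolvent-⊆ (_ , _ , _ , spec , _) m∈r with proj₁ (spec _) m∈r
... | inj₁ (m∈c₁ , _) = inj₁ m∈c₁
... | inj₂ (m∈c₂ , _) = inj₂ m∈c₂

Resolvent-keepsˡ : ∀ {c₁ c₂ r m} → Resolvent c₁ c₂ r → m ∈ c₁ → (~ m) ∉ c₂ → m ∈ r
Resolvent-keepsˡ (p , _ , ~p∈c₂ , spec , _) m∈c₁ ~m∉c₂ =
  proj₂ (spec _) (inj₁ (m∈c₁ , λ { refl → ~m∉c₂ ~p∈c₂ }))

Resolvent-keepsʳ : ∀ {c₁ c₂ r m} → Resolvent c₁ c₂ r → m ∈ c₂ → (~ m) ∉ c₁ → m ∈ r
Resolvent-keepsʳ {c₁} {m = m} (p , p∈c₁ , _ , spec , _) m∈c₂ ~m∉c₁ =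
  proj₂ (spec _) (inj₂ (m∈c₂ , m≢~p))
  where
  m≢~p : m ≢ ~ p
  m≢~p m≡~p = ~m∉c₁ (subst (_∈ c₁) (trans (sym (~-involutive p)) (cong ~_ (sym m≡~p))) p∈c₁)

ResCn-mono : ∀ {F G} → (∀ {d} → d ∈F G → d ∈F F) → ∀ {d} → ResCn G d → ResCn F d
ResCn-mono G⊆F (base d∈G)  = base (G⊆F d∈G)
ResCn-mono G⊆F (step a b r) = step (ResCn-mono G⊆F a) (ResCn-mono G⊆F b) r

ResCn-¬Tautology : ∀ {F d} → NoTaut F → ResCn F d → ¬ Tautology d
ResCn-¬Tautology noTaut (base d∈F)                     = noTaut _ d∈F
ResCn-¬Tautology _      (step _ _ (_ , _ , _ , _ , ¬taut)) = ¬taut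

ResCn-¬Occurs : ∀ {F x} → (∀ d → d ∈F F → ¬ Occurs x d) → ∀ {d} → ResCn F d → ¬ Occurs x d
ResCn-¬Occurs ¬occ (base d∈F) = ¬occ _ d∈F
ResCn-¬Occurs ¬occ (step a b r) (inj₁ p∈) with Resolvent-⊆ r p∈
... | inj₁ p∈c₁ = ResCn-¬Occurs ¬occ a (inj₁ p∈c₁)
... | inj₂ p∈c₂ = ResCn-¬Occurs ¬occ b (inj₁ p∈c₂)
ResCn-¬Occurs ¬occ (step a b r) (inj₂ n∈) with Resolvent-⊆ r n∈
... | inj₁ n∈c₁ = ResCn-¬Occurs ¬occ a (inj₂ n∈c₁)
... | inj₂ n∈c₂ = ResCn-¬Occurs ¬occ b (inj₂ n∈c₂)

_[_≔_] : Assignment → ℕ → Bool → Assignment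
(σ [ x ≔ b ]) z = if does (z ≟ x) then b else σ z

polarity : Lit → Bool
polarity (pos _) = true
polarity (neg _) = false

evalLit-[var≔polarity] : ∀ σ l → evalLit (σ [ var l ≔ polarity l ]) l ≡ true
evalLit-[var≔polarity] σ (pos x) rewrite dec-true (x ≟ x) refl = refl
evalLit-[var≔polarity] σ (neg x) rewrite dec-true (x ≟ x) refl = refl

evalLit-[≔]-other : ∀ σ x b m → var m ≢ x → evalLit (σ [ x ≔ b ]) m ≡ evalLit σ m
evalLit-[≔]-other σ x b (pos z) z≢x rewrite dec-false (z ≟ x) z≢x = refl
evalLit-[≔]-other σ x b (neg z) z≢x rewrite dec-false (z ≟ x) z≢x = refl

Sat-[≔]-¬Occurs : ∀ σ x b d → ¬ Occurs x d → Sat σ d ⇔ Sat (σ [ x ≔ b ]) d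
Sat-[≔]-¬Occurs σ x b d ¬occ = mk⇔
  (λ (m , m∈d , sat) → m , m∈d , trans (agrees m∈d) sat)
  (λ (m , m∈d , sat) → m , m∈d , trans (sym (agrees m∈d)) sat)
  where
  agrees : ∀ {m} → m ∈ d → evalLit (σ [ x ≔ b ]) m ≡ evalLit σ m
  agrees {m} m∈d = evalLit-[≔]-other σ x b m λ { refl → ¬occ (∈⇒Occurs-var m∈d) }

module IsolatedLiteral (F : Formula) (c : Clause) (noTaut : NoTaut F)
  (l : Lit) (l∈c : l ∈ c) (isolated : ∀ d → d ∈F F → Occurs (var l) d → d ≋ c) where

  ResCn-∖F-¬Occurs : ∀ {d} → ResCn (F ∖F c) d → ¬ Occurs (var l) d
  ResCn-∖F-¬Occurs = ResCn-¬Occurs λ d d∈F∖c occ →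
    let d∈F , d≉c = ∈F-∖F⁻ d∈F∖c in d≉c (isolated d d∈F occ)

  ResCn-∖F-∌~l : ∀ {d} → ResCn (F ∖F c) d → (~ l) ∉ d
  ResCn-∖F-∌~l d∈ ~l∈d = ResCn-∖F-¬Occurs d∈ (~∈⇒Occurs-var ~l∈d)

  ResCn-∖F-or-∋ : ∀ {d} → ResCn F d → ResCn (F ∖F c) d ⊎ l ∈ d
  ResCn-∖F-or-∋ {d} (base d∈F) with d ≋? c
  ... | yes d≋c = inj₂ (proj₂ d≋c l∈c)
  ... | no d≉c  = inj₁ (base (∈F-∖F⁺ d∈F d≉c))
  ResCn-∖F-or-∋ (step a b r) with ResCn-∖F-or-∋ a | ResCn-∖F-or-∋ b
  ... | inj₁ a′   | inj₁ b′   = inj₁ (step a′ b′ r)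
  ... | inj₂ l∈c₁ | inj₁ b′   = inj₂ (Resolvent-keepsˡ r l∈c₁ (ResCn-∖F-∌~l b′))
  ... | inj₂ l∈c₁ | inj₂ l∈c₂ = inj₂ (Resolvent-keepsˡ r l∈c₁ λ ~l∈c₂ →
                                    ResCn-¬Tautology noTaut b (l , l∈c₂ , ~l∈c₂))
  ... | inj₁ a′   | inj₂ l∈c₂ = inj₂ (Resolvent-keepsʳ r l∈c₂ (ResCn-∖F-∌~l a′))

  satisfies-ResCn : ∀ {c′} σ → (∀ d → ResCn (F ∖F c) d → ¬ (d ≋ c′) → Sat σ d)
    → ∀ d → ResCn F d → ¬ (d ≋ c′) → Sat (σ [ var l ≔ polarity l ]) d
  satisfies-ResCn σ satRest d d∈ d≉c′ with ResCn-∖F-or-∋ d∈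
  ... | inj₂ l∈d = l , l∈d , evalLit-[var≔polarity] σ l
  ... | inj₁ d∈′ = Equivalence.to
    (Sat-[≔]-¬Occurs σ (var l) (polarity l) d (ResCn-∖F-¬Occurs d∈′))
    (satRest d d∈′ d≉c′)

  superredundant-∖F : ∀ c′ → c′ ∈F F → ¬ (c′ ≋ c)
    → Superredundant F c′ ⇔ Superredundant (F ∖F c) c′
  superredundant-∖F c′ c′∈F c′≉c = mk⇔ to from
    where
    c′-¬Occurs : ¬ Occurs (var l) c′
    c′-¬Occurs occ = c′≉c (isolated c′ c′∈F occ)

    to : Superredundant F c′ → Superredundant (F ∖F c) c′
    to (_ , redundant) = ∈F-∖F⁺ c′∈F c′≉c , λ σ satRest →
      Equivalence.from (Sat-[≔]-¬Occurs σ (var l) (polarity l) c′ c′-¬Occurs)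
        (redundant (σ [ var l ≔ polarity l ]) (satisfies-ResCn σ satRest))

    from : Superredundant (F ∖F c) c′ → Superredundant F c′
    from (_ , redundant) = c′∈F , λ σ satRest →
      redundant σ λ d d∈ → satRest d (ResCn-mono (λ d∈F∖c → proj₁ (∈F-∖F⁻ d∈F∖c)) d∈)

corollary1 : (F : Formula) (c : Clause) → NoTaut F → c ∈F F
    → ∃[ x ] (Occurs x c × (∀ d → d ∈F F → Occurs x d → d ≋ c))
    → ∀ c′ → c′ ∈F F → ¬ (c′ ≋ c)
    → Superredundant F c′ ⇔ Superredundant (F ∖F c) c′
corollary1 F c noTaut _ (x , inj₁ px∈c , isolated) =
  IsolatedLiteral.superredundant-∖F F c noTaut (pos x) px∈c isolated
corollary1 F c noTaut _ (x , inj₂ nx∈c , isolated) =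
  IsolatedLiteral.superredundant-∖F F c noTaut (neg x) nx∈c isolated
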